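{- Let $\Delta$ be the hexagonal packing of (unit-radius) circles in the plane. Then there exists a partition of the circles of $\Delta$ into four equivalence classes such that the distance between any two distinct circles in the same equivalence class is at least $1$.
   Context: The hexagonal packing of unit circles is the arrangement of radius-$1$ circles in $\mathbb{R}^2$ centered at the points of a triangular lattice with minimum distance $2$, so each circle is tangent to six others. The distance between two circles is the minimum Euclidean distance between a point of one and a point of the other (as closed disks). -}

module Defs where

open import Data.Integer using (ℤ; _+_; _-_; _*_; _≤_; +_)
open import Data.Product using (_×_; _,_; Σ)
open import Data.Fin using (Fin)
open import Relation.Binary.PropositionalEquality using (_≡_)
open import Relation.Nullary using (¬_)

-- Circles of the hexagonal packing Δ are indexed by lattice coordinates
-- (a , b) ∈ ℤ², the circle with index (a , b) being the unit circle
-- centred at  a·(2,0) + b·(1,√3) = (2a + b , b√3).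
Circle : Set
Circle = ℤ × ℤ

-- Squared Euclidean distance between the centres of two circles:
-- (2Δa + Δb)² + (Δb·√3)² = (2Δa + Δb)² + 3Δb²   (an exact integer).
centreDistSq : Circle → Circle → ℤ
centreDistSq (a , b) (c , d) =
  let da = a - c
      db = b - d
      x  = (+ 2) * da + db
  in x * x + (+ 3) * (db * db)

-- Distance between two (closed unit) disks whose centres are at distance
-- D ≥ 0 is max(0, D - 2).  Hence "distance ≥ 1" ⇔ D ≥ 3 ⇔ D² ≥ 9.
CircleDistAtLeast1 : Circle → Circle → Set
CircleDistAtLeast1 p q = + 9 ≤ centreDistSq p q

-- A partition of the circles into four equivalence classes: the classes are
-- the fibres of a surjective map onto a four-element set.
Surjective4 : (Circle → Fin 4) → Set
Surjective4 f = (i : Fin 4) → Σ Circle (λ p → f p ≡ i)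

{-# OPTIONS --safe #-}
module Submission where

-- Colour the circle (a , b) by the parities of a and b. Two distinct circles
-- of the same colour differ by twice a nonzero lattice vector (s , t), so the
-- squared distance of their centres is 4((2s + t)² + 3t²) ≥ 4 · 3 > 9.

open import Defs
open import Data.Fin using (Fin; fromℕ<; combine)
open import Data.Fin.Patterns using (0F; 1F; 2F; 3F)
open import Data.Fin.Properties using (fromℕ<-injective; combine-injective)
open import Data.Integer using (ℤ; +_; -[1+_]; _+_; _-_; _*_; _≤_; +≤+; _/_; _%_; _≟_)
open import Data.Integer.DivMod using (a≡a%n+[a/n]*n; n%d<d)
open import Data.Integer.Properties using (≤-trans; +-mono-≤; *-monoˡ-≤-nonNeg; i-j≡0⇒i≡j; module ≤-Reasoning)
open import Data.Integer.Tactic.RingSolver using (solve-∀)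
open import Data.Nat using (ℕ; suc; NonZero; s≤s; z≤n)
open import Data.Nat.Properties using (m≤m+n; n≤1+n)
open import Data.Product using (Σ; _×_; _,_)
open import Relation.Binary.PropositionalEquality
  using (_≡_; _≢_; refl; sym; trans; cong; cong₂; subst; module ≡-Reasoning)
open import Relation.Nullary using (¬_; yes; no; contradiction)

residue : (n : ℕ) .{{_ : NonZero n}} → ℤ → Fin n
residue n a = fromℕ< (n%d<d a (+ n))

residue-≡⇒-≡* : ∀ n .{{_ : NonZero n}} a c → residue n a ≡ residue n c →
                a - c ≡ (a / + n - c / + n) * + n
residue-≡⇒-≡* n a c eq = begin
  a - c                                         ≡⟨ cong₂ _-_ (a≡a%n+[a/n]*n a (+ n)) c≡ ⟩
  (+ r + a / + n * + n) - (+ r + c / + n * + n) ≡⟨ cancel (+ r) (a / + n) (c / + n) (+ n) ⟩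
  (a / + n - c / + n) * + n                     ∎
  where
  open ≡-Reasoning
  r = a % + n
  c≡ : c ≡ + r + c / + n * + n
  c≡ rewrite fromℕ<-injective r (c % + n) (n%d<d a (+ n)) (n%d<d c (+ n)) eq =
    a≡a%n+[a/n]*n c (+ n)
  cancel : ∀ r x y n → (r + x * n) - (r + y * n) ≡ (x - y) * n
  cancel = solve-∀

latticeNormSq : ℤ → ℤ → ℤ
latticeNormSq s t = let x = + 2 * s + t in x * x + + 3 * (t * t)

centreDistSq≡latticeNormSq : ∀ a b c d →
                             centreDistSq (a , b) (c , d) ≡ latticeNormSq (a - c) (b - d)
centreDistSq≡latticeNormSq a b c d = refl

latticeNormSq-*2 : ∀ s t → latticeNormSq (s * + 2) (t * + 2) ≡ + 4 * latticeNormSq s t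
latticeNormSq-*2 = expanded
  where
  expanded : ∀ s t →
    (+ 2 * (s * + 2) + t * + 2) * (+ 2 * (s * + 2) + t * + 2) + + 3 * ((t * + 2) * (t * + 2))
    ≡ + 4 * ((+ 2 * s + t) * (+ 2 * s + t) + + 3 * (t * t))
  expanded = solve-∀

square-nonNeg : ∀ i → + 0 ≤ i * i
square-nonNeg (+ 0)      = +≤+ z≤n
square-nonNeg (+ suc n)  = +≤+ z≤n
square-nonNeg -[1+ n ]   = +≤+ z≤n

square-pos : ∀ {i} → i ≢ + 0 → + 1 ≤ i * i
square-pos {+ 0}       i≢0 = contradiction refl i≢0
square-pos {+ suc n}   _   = +≤+ (s≤s z≤n)
square-pos { -[1+ n ]} _   = +≤+ (s≤s z≤n)

latticeNormSq-≥3 : ∀ s t → ¬ (s ≡ + 0 × t ≡ + 0) → + 3 ≤ latticeNormSq s t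
latticeNormSq-≥3 s t st≢0 with t ≟ + 0
... | no t≢0   = +-mono-≤ (square-nonNeg (+ 2 * s + t)) (*-monoˡ-≤-nonNeg (+ 3) (square-pos t≢0))
... | yes refl = subst (+ 3 ≤_) (sym (horizontal s))
                   (≤-trans (+≤+ (n≤1+n 3))
                            (*-monoˡ-≤-nonNeg (+ 4) (square-pos (λ s≡0 → st≢0 (s≡0 , refl)))))
  where
  horizontal : ∀ s → (+ 2 * s + + 0) * (+ 2 * s + + 0) + + 3 * (+ 0 * + 0) ≡ + 4 * (s * s)
  horizontal = solve-∀

parityClass : Circle → Fin 4
parityClass (a , b) = combine (residue 2 a) (residue 2 b)

parityClass-surjective : Surjective4 parityClass
parityClass-surjective 0F = (+ 0 , + 0) , refl
parityClass-surjective 1F = (+ 0 , + 1) , refl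
parityClass-surjective 2F = (+ 1 , + 0) , refl
parityClass-surjective 3F = (+ 1 , + 1) , refl

parityClass-separated : (p q : Circle) → p ≢ q → parityClass p ≡ parityClass q →
                        CircleDistAtLeast1 p q
parityClass-separated (a , b) (c , d) p≢q same
  with ra≡rc , rb≡rd ← combine-injective (residue 2 a) (residue 2 b) (residue 2 c) (residue 2 d) same
  = begin
  + 9                                   ≤⟨ +≤+ (m≤m+n 9 3) ⟩
  + 4 * + 3                             ≤⟨ *-monoˡ-≤-nonNeg (+ 4) (latticeNormSq-≥3 s t st≢0) ⟩
  + 4 * latticeNormSq s t               ≡⟨ latticeNormSq-*2 s t ⟨
  latticeNormSq (s * + 2) (t * + 2)     ≡⟨ cong₂ latticeNormSq a-c≡ b-d≡ ⟨
  latticeNormSq (a - c) (b - d)         ≡⟨ centreDistSq≡latticeNormSq a b c d ⟨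
  centreDistSq (a , b) (c , d)          ∎
  where
  open ≤-Reasoning
  s = a / + 2 - c / + 2
  t = b / + 2 - d / + 2
  a-c≡ : a - c ≡ s * + 2
  a-c≡ = residue-≡⇒-≡* 2 a c ra≡rc
  b-d≡ : b - d ≡ t * + 2
  b-d≡ = residue-≡⇒-≡* 2 b d rb≡rd
  st≢0 : ¬ (s ≡ + 0 × t ≡ + 0)
  st≢0 (s≡0 , t≡0) = p≢q (cong₂ _,_ (i-j≡0⇒i≡j a c (trans a-c≡ (cong (_* + 2) s≡0)))
                                    (i-j≡0⇒i≡j b d (trans b-d≡ (cong (_* + 2) t≡0))))

mainTheorem9 : Σ (Circle → Fin 4) (λ f → Surjective4 f ×
                 ((p q : Circle) → ¬ (p ≡ q) → f p ≡ f q → CircleDistAtLeast1 p q))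
mainTheorem9 = parityClass , parityClass-surjective , parityClass-separated
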